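{- Let $C$ be a convex sublattice of a lattice $L$ and let $\Lambda$ be a chain. Then the set $M$ of all antitone maps $x\colon\Lambda\to L$ (i.e. $x\in L^\Lambda$) such that $x[\Lambda]\cap C\neq\varnothing$ is a sublattice of $L^\Lambda$.
   Context: $L^\Lambda$ is the direct power with componentwise operations; a map $x$ is antitone if $\xi\leq\eta$ implies $x(\eta)\leq x(\xi)$. -}

module Defs where

open import Level using (Level; _⊔_)
open import Data.Product using (Σ; _×_)
open import Relation.Unary using (Pred; _∈_)
open import Relation.Binary.Bundles using (TotalOrder)
open import Relation.Binary.Lattice.Bundles using (Lattice)

module _ {c ℓ₁ ℓ₂ : Level} (L : Lattice c ℓ₁ ℓ₂) where
  open Lattice L

  IsSublattice : {p : Level} → Pred Carrier p → Set (c ⊔ p)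
  IsSublattice C = ∀ {a b} → a ∈ C → b ∈ C → (a ∨ b) ∈ C × (a ∧ b) ∈ C

  IsConvex : {p : Level} → Pred Carrier p → Set (c ⊔ ℓ₂ ⊔ p)
  IsConvex C = ∀ {a x b} → a ∈ C → b ∈ C → a ≤ x → x ≤ b → x ∈ C

  IsConvexSublattice : {p : Level} → Pred Carrier p → Set (c ⊔ ℓ₂ ⊔ p)
  IsConvexSublattice C = IsSublattice C × IsConvex C

  module _ {k m₁ m₂ : Level} (Λ : TotalOrder k m₁ m₂) where
    private module Λ = TotalOrder Λ

    _∨ᴾ_ : (Λ.Carrier → Carrier) → (Λ.Carrier → Carrier) → (Λ.Carrier → Carrier)
    (x ∨ᴾ y) ξ = x ξ ∨ y ξ

    _∧ᴾ_ : (Λ.Carrier → Carrier) → (Λ.Carrier → Carrier) → (Λ.Carrier → Carrier)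
    (x ∧ᴾ y) ξ = x ξ ∧ y ξ

    Antitone : (Λ.Carrier → Carrier) → Set (k ⊔ m₂ ⊔ ℓ₂)
    Antitone x = ∀ {ξ η} → ξ Λ.≤ η → x η ≤ x ξ

    M : {p : Level} → Pred Carrier p → Pred (Λ.Carrier → Carrier) (k ⊔ m₂ ⊔ ℓ₂ ⊔ p)
    M C x = Antitone x × Σ Λ.Carrier (λ ξ → x ξ ∈ C)

    IsSublatticeᴾ : {p : Level} → Pred (Λ.Carrier → Carrier) p → Set (c ⊔ k ⊔ p)
    IsSublatticeᴾ S = ∀ {x y} → x ∈ S → y ∈ S → (x ∨ᴾ y) ∈ S × (x ∧ᴾ y) ∈ S

-- For the
-- intersection with C, take x ξ ∈ C and y η ∈ C with, say, ξ ≤ η.  Then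
-- y η ≤ x η ∨ y η ≤ x ξ ∨ y η, and both bounds lie in the sublattice C, so
-- convexity puts (x ∨ y) η in C; dually (x ∧ y) ξ lies between
-- x ξ ∧ y η and x ξ.
module Submission where

open import Defs
open import Level using (Level)
open import Data.Product using (Σ; _,_; proj₁; proj₂)
open import Data.Sum using (inj₁; inj₂)
open import Relation.Unary using (Pred; _∈_)
open import Relation.Binary.Bundles using (TotalOrder)
open import Relation.Binary.Lattice.Bundles using (Lattice)
import Relation.Binary.Lattice.Properties.JoinSemilattice as JoinProperties
import Relation.Binary.Lattice.Properties.MeetSemilattice as MeetProperties

module _ {c ℓ₁ ℓ₂ k m₁ m₂ : Level}
  (L : Lattice c ℓ₁ ℓ₂) (Λ : TotalOrder k m₁ m₂) where

  open Lattice L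
  open JoinProperties joinSemilattice using (∨-monotonic)
  open MeetProperties meetSemilattice using (∧-monotonic)
  private module Λ = TotalOrder Λ

  antitone-∨ᴾ : ∀ {x y} → Antitone L Λ x → Antitone L Λ y →
    Antitone L Λ (_∨ᴾ_ L Λ x y)
  antitone-∨ᴾ x↓ y↓ ξ≤η = ∨-monotonic (x↓ ξ≤η) (y↓ ξ≤η)

  antitone-∧ᴾ : ∀ {x y} → Antitone L Λ x → Antitone L Λ y →
    Antitone L Λ (_∧ᴾ_ L Λ x y)
  antitone-∧ᴾ x↓ y↓ ξ≤η = ∧-monotonic (x↓ ξ≤η) (y↓ ξ≤η)

  module _ {p : Level} {C : Pred Carrier p} (C-convex-sublattice : IsConvexSublattice L C) where

    private
      closed = proj₁ C-convex-sublattice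
      convex = proj₂ C-convex-sublattice

    ∨ᴾ-meets : ∀ {x y ξ η} → Antitone L Λ x → Antitone L Λ y →
      x ξ ∈ C → y η ∈ C → Σ Λ.Carrier (λ ζ → x ζ ∨ y ζ ∈ C)
    ∨ᴾ-meets {ξ = ξ} {η} x↓ y↓ xξ∈C yη∈C with Λ.total ξ η
    ... | inj₁ ξ≤η = η , convex yη∈C (proj₁ (closed xξ∈C yη∈C))
                                (y≤x∨y _ _) (∨-monotonic (x↓ ξ≤η) refl)
    ... | inj₂ η≤ξ = ξ , convex xξ∈C (proj₁ (closed xξ∈C yη∈C))
                                (x≤x∨y _ _) (∨-monotonic refl (y↓ η≤ξ))

    ∧ᴾ-meets : ∀ {x y ξ η} → Antitone L Λ x → Antitone L Λ y →
      x ξ ∈ C → y η ∈ C → Σ Λ.Carrier (λ ζ → x ζ ∧ y ζ ∈ C)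
    ∧ᴾ-meets {ξ = ξ} {η} x↓ y↓ xξ∈C yη∈C with Λ.total ξ η
    ... | inj₁ ξ≤η = ξ , convex (proj₂ (closed xξ∈C yη∈C)) xξ∈C
                                (∧-monotonic refl (y↓ ξ≤η)) (x∧y≤x _ _)
    ... | inj₂ η≤ξ = η , convex (proj₂ (closed xξ∈C yη∈C)) yη∈C
                                (∧-monotonic (x↓ η≤ξ) refl) (x∧y≤y _ _)

lemma5p2 : {c ℓ₁ ℓ₂ k m₁ m₂ p : Level}
    (L : Lattice c ℓ₁ ℓ₂) (Λ : TotalOrder k m₁ m₂)
    (C : Pred (Lattice.Carrier L) p) → IsConvexSublattice L C →
    IsSublatticeᴾ L Λ (M L Λ C)
lemma5p2 L Λ C C-convex-sublattice (x↓ , _ , xξ∈C) (y↓ , _ , yη∈C) =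
  (antitone-∨ᴾ L Λ x↓ y↓ , ∨ᴾ-meets L Λ C-convex-sublattice x↓ y↓ xξ∈C yη∈C) ,
  (antitone-∧ᴾ L Λ x↓ y↓ , ∧ᴾ-meets L Λ C-convex-sublattice x↓ y↓ xξ∈C yη∈C)
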